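{- Let $m\geq 3$ be an odd integer, and let $\ell=\lceil\log_2 m\rceil$. Suppose there is a positive integer $j$ such that ${\bf t}_j{\bf t}_{j+1}={\bf t}_{m+j}{\bf t}_{m+j+1}$. Then $\mathfrak K(m)<\left(1+\frac{j+1}{m}\right)2^\ell$.
   Context: The Thue-Morse word is the infinite binary word ${\bf t}={\bf t}_1{\bf t}_2{\bf t}_3\cdots$, where ${\bf t}_i\in\{0,1\}$ has the same parity as the number of $1$'s in the binary expansion of $i-1$. A $k$-anti-power is a word of the form $w_1w_2\cdots w_k$ where $w_1,\ldots,w_k$ are pairwise distinct words all of the same length. For a positive integer $m$, $\mathfrak K(m)$ denotes the smallest positive integer $k$ such that the prefix of ${\bf t}$ of length $km$ is not a $k$-anti-power. -}

module Defs where

open import Data.Nat using (ℕ; zero; suc; _+_; _*_; _∸_; _≤_; _<_; ⌊_/2⌋)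
open import Data.Nat.DivMod using (_%_)
open import Data.Bool using (Bool; true; false; not; _xor_)
open import Data.Fin using (Fin; toℕ)
open import Data.Vec using (Vec; tabulate)
open import Data.Product using (_×_)
open import Relation.Binary.PropositionalEquality using (_≡_; _≢_)
open import Relation.Nullary using (¬_)

-- Number of 1's in the binary expansion of n (fuel = n suffices, since
-- each step halves n).
popcount-aux : ℕ → ℕ → ℕ
popcount-aux zero    n = 0
popcount-aux (suc f) n = (n % 2) + popcount-aux f ⌊ n /2⌋

popcount : ℕ → ℕ
popcount n = popcount-aux n n

bit : ℕ → Bool
bit n with n % 2
... | zero = false
... | suc _ = true

-- Thue–Morse word, 1-indexed: t i has the parity of popcount (i - 1).
-- (t 0 is a junk value never used.)
t : ℕ → Bool
t i = bit (popcount (i ∸ 1))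

block : (m : ℕ) → ℕ → Vec Bool m
block m i = tabulate {n = m} (λ r → t (i * m + toℕ r + 1))

AntiPowerPrefix : ℕ → ℕ → Set
AntiPowerPrefix k m = ∀ i i' → i < k → i' < k → i ≢ i' → block m i ≢ block m i'

IsK : ℕ → ℕ → Set
IsK m k = (1 ≤ k) × ¬ AntiPowerPrefix k m
        × (∀ k' → 1 ≤ k' → k' < k → AntiPowerPrefix k' m)

-- Let L = 2 ^ ⌈log₂ m⌉ ≥ m and j = n + 1, and let tm be the Thue–Morse word indexed from 0.
-- Since tm (2 ^ ℓ * x + r) = tm x xor tm r for r < 2 ^ ℓ, the factor of length 2L of tm at
-- position L x depends only on tm x and tm (x + 1). The hypothesis makes these agree for
-- x = n and x = m + n, so the factors of length 2L at L n and L (m + n) coincide. The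
-- block i with L n ≤ i m < L n + m lies in the first factor, and block i + L is its
-- translate by L m, inside the second; so they are equal, 𝔎(m) ≤ i + L + 1, and the
-- bound follows from i m < L n + m and m ≤ L.

module Submission where

open import Defs
open import Data.Nat using (ℕ; _+_; _*_; _^_; _≤_; _<_)
open import Data.Nat.Divisibility using (_∣_)
open import Data.Nat.Logarithm using (⌈log₂_⌉)
open import Data.Product using (_×_; ∃-syntax)
open import Relation.Binary.PropositionalEquality using (_≡_)
open import Relation.Nullary using (¬_)

open import Algebra.Properties.CommutativeSemigroup using (x∙yz≈y∙xz)
open import Data.Bool using (Bool; not; _xor_)
open import Data.Bool.Properties using (not-distribˡ-xor) renaming (_≟_ to _≟ᵇ_)
open import Data.Fin using (toℕ)
open import Data.Fin.Properties using (toℕ<n)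
open import Data.Nat using (zero; suc; _∸_; ⌊_/2⌋; ⌈_/2⌉; z≤n; s≤s; z<s; NonZero; _≟_; _<?_)
open import Data.Nat.DivMod using (_%_; [m+kn]%n≡m%n)
open import Data.Nat.Induction using (<-wellFounded)
open import Data.Nat.Logarithm.Core using (⌈log2⌉)
open import Data.Nat.Properties
open import Data.Nat.Tactic.RingSolver using (solve-∀)
open import Data.Product using (_,_; ∃₂)
open import Data.Sum using (_⊎_; inj₁; inj₂)
open import Data.Vec.Properties using (tabulate-cong; ≡-dec)
open import Function using (_∘′_)
open import Induction.WellFounded using (Acc; acc)
open import Relation.Binary.PropositionalEquality
  using (refl; sym; trans; cong; cong₂; subst; _≢_; module ≡-Reasoning)
open import Relation.Nullary using (Dec; yes; no; ¬?; contradiction)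
open import Relation.Nullary.Decidable using (map′; _→-dec_)
open import Relation.Unary using (Decidable)

popcount-aux-zero : ∀ f → popcount-aux f 0 ≡ 0
popcount-aux-zero zero    = refl
popcount-aux-zero (suc f) = popcount-aux-zero f

⌊1+n/2⌋≤n : ∀ n → ⌊ suc n /2⌋ ≤ n
⌊1+n/2⌋≤n n = m<1+n⇒m≤n (⌊n/2⌋<n n)

popcount-aux-fuel : ∀ {f g} n → n ≤ f → n ≤ g → popcount-aux f n ≡ popcount-aux g n
popcount-aux-fuel {f} {g} zero _ _ = trans (popcount-aux-zero f) (sym (popcount-aux-zero g))
popcount-aux-fuel {suc f} {suc g} (suc n) (s≤s n≤f) (s≤s n≤g) =
  cong (suc n % 2 +_)
       (popcount-aux-fuel ⌊ suc n /2⌋ (≤-trans (⌊1+n/2⌋≤n n) n≤f) (≤-trans (⌊1+n/2⌋≤n n) n≤g))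

popcount-unfold : ∀ n → popcount n ≡ n % 2 + popcount ⌊ n /2⌋
popcount-unfold zero    = refl
popcount-unfold (suc n) =
  cong (suc n % 2 +_) (popcount-aux-fuel ⌊ suc n /2⌋ (⌊1+n/2⌋≤n n) ≤-refl)

⌊m*2+n/2⌋≡m+⌊n/2⌋ : ∀ m n → ⌊ m * 2 + n /2⌋ ≡ m + ⌊ n /2⌋
⌊m*2+n/2⌋≡m+⌊n/2⌋ zero    n = refl
⌊m*2+n/2⌋≡m+⌊n/2⌋ (suc m) n = cong suc (⌊m*2+n/2⌋≡m+⌊n/2⌋ m n)

[m*2+n]%2≡n%2 : ∀ m n → (m * 2 + n) % 2 ≡ n % 2
[m*2+n]%2≡n%2 m n = trans (cong (_% 2) (+-comm (m * 2) n)) ([m+kn]%n≡m%n n m 2)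

n<m*2⇒⌊n/2⌋<m : ∀ {n} m → n < m * 2 → ⌊ n /2⌋ < m
n<m*2⇒⌊n/2⌋<m {n} m n<m*2 = begin
  ⌊ 2 + n /2⌋      ≤⟨ ⌊n/2⌋-mono (s≤s n<m*2) ⟩
  ⌊ 1 + m * 2 /2⌋  ≡⟨ cong ⌊_/2⌋ (+-comm 1 (m * 2)) ⟩
  ⌊ m * 2 + 1 /2⌋  ≡⟨ ⌊m*2+n/2⌋≡m+⌊n/2⌋ m 1 ⟩
  m + 0            ≡⟨ +-identityʳ m ⟩
  m                ∎
  where open ≤-Reasoning

popcount-concat : ∀ ℓ x {r} → r < 2 ^ ℓ → popcount (2 ^ ℓ * x + r) ≡ popcount x + popcount r
popcount-concat zero    x (s≤s z≤n) =
  trans (cong popcount (trans (+-identityʳ (1 * x)) (*-identityˡ x))) (sym (+-identityʳ _))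
popcount-concat (suc ℓ) x {r} r<2^[1+ℓ] = begin
  popcount (2 ^ suc ℓ * x + r)               ≡⟨ cong (λ y → popcount (y + r)) shift ⟩
  popcount (y * 2 + r)                       ≡⟨ popcount-unfold (y * 2 + r) ⟩
  (y * 2 + r) % 2 + popcount ⌊ y * 2 + r /2⌋ ≡⟨ cong₂ _+_ ([m*2+n]%2≡n%2 y r)
                                                         (cong popcount (⌊m*2+n/2⌋≡m+⌊n/2⌋ y r)) ⟩
  r % 2 + popcount (y + ⌊ r /2⌋)             ≡⟨ cong (r % 2 +_) (popcount-concat ℓ x ⌊r/2⌋<2^ℓ) ⟩
  r % 2 + (popcount x + popcount ⌊ r /2⌋)    ≡⟨ x∙yz≈y∙xz +-commutativeSemigroup (r % 2) (popcount x) _ ⟩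
  popcount x + (r % 2 + popcount ⌊ r /2⌋)    ≡⟨ cong (popcount x +_) (popcount-unfold r) ⟨
  popcount x + popcount r                    ∎
  where
  open ≡-Reasoning
  y : ℕ
  y = 2 ^ ℓ * x
  shift : 2 ^ suc ℓ * x ≡ y * 2
  shift = trans (*-assoc 2 (2 ^ ℓ) x) (*-comm 2 y)
  ⌊r/2⌋<2^ℓ : ⌊ r /2⌋ < 2 ^ ℓ
  ⌊r/2⌋<2^ℓ = n<m*2⇒⌊n/2⌋<m (2 ^ ℓ) (<-≤-trans r<2^[1+ℓ] (≤-reflexive (*-comm 2 (2 ^ ℓ))))

bit-suc : ∀ n → bit (suc n) ≡ not (bit n)
bit-suc zero          = refl
bit-suc (suc zero)    = refl
bit-suc (suc (suc n)) = bit-suc n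

bit-+ : ∀ m n → bit (m + n) ≡ bit m xor bit n
bit-+ zero    n = refl
bit-+ (suc m) n = begin
  bit (suc (m + n))         ≡⟨ bit-suc (m + n) ⟩
  not (bit (m + n))         ≡⟨ cong not (bit-+ m n) ⟩
  not (bit m xor bit n)     ≡⟨ not-distribˡ-xor (bit m) (bit n) ⟩
  not (bit m) xor bit n     ≡⟨ cong (_xor bit n) (bit-suc m) ⟨
  bit (suc m) xor bit n     ∎
  where open ≡-Reasoning

tm : ℕ → Bool
tm n = bit (popcount n)

t-+1 : ∀ n → t (n + 1) ≡ tm n
t-+1 n = cong (bit ∘′ popcount) (m+n∸n≡m n 1)

tm-concat : ∀ ℓ x {r} → r < 2 ^ ℓ → tm (2 ^ ℓ * x + r) ≡ tm x xor tm r
tm-concat ℓ x {r} r<2^ℓ =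
  trans (cong bit (popcount-concat ℓ x r<2^ℓ)) (bit-+ (popcount x) (popcount r))

tm-agree : ∀ ℓ {x y r} → tm x ≡ tm y → r < 2 ^ ℓ → tm (2 ^ ℓ * x + r) ≡ tm (2 ^ ℓ * y + r)
tm-agree ℓ {x} {y} {r} tmx≡tmy r<2^ℓ = begin
  tm (2 ^ ℓ * x + r)  ≡⟨ tm-concat ℓ x r<2^ℓ ⟩
  tm x xor tm r       ≡⟨ cong (_xor tm r) tmx≡tmy ⟩
  tm y xor tm r       ≡⟨ tm-concat ℓ y r<2^ℓ ⟨
  tm (2 ^ ℓ * y + r)  ∎
  where open ≡-Reasoning

tm-agree₂ : ∀ ℓ {x y u} → tm x ≡ tm y → tm (suc x) ≡ tm (suc y) → u < 2 ^ ℓ + 2 ^ ℓ →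
            tm (2 ^ ℓ * x + u) ≡ tm (2 ^ ℓ * y + u)
tm-agree₂ ℓ {x} {y} {u} tmx≡tmy _ _ with u <? 2 ^ ℓ
... | yes u<2^ℓ = tm-agree ℓ tmx≡tmy u<2^ℓ
tm-agree₂ ℓ {x} {y} {u} _ tm[1+x]≡tm[1+y] u<2^[1+ℓ] | no u≮2^ℓ = begin
  tm (L * x + u)        ≡⟨ cong tm (carry x) ⟨
  tm (L * suc x + v)    ≡⟨ tm-agree ℓ tm[1+x]≡tm[1+y] v<L ⟩
  tm (L * suc y + v)    ≡⟨ cong tm (carry y) ⟩
  tm (L * y + u)        ∎
  where
  open ≡-Reasoning
  L v : ℕ
  L = 2 ^ ℓ
  v = u ∸ L
  L+v≡u : L + v ≡ u
  L+v≡u = m+[n∸m]≡n (≮⇒≥ u≮2^ℓ)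
  v<L : v < L
  v<L = +-cancelˡ-< L v L (subst (_< L + L) (sym L+v≡u) u<2^[1+ℓ])
  carry : ∀ z → L * suc z + v ≡ L * z + u
  carry z = begin
    L * suc z + v   ≡⟨ cong (_+ v) (*-suc L z) ⟩
    L + L * z + v   ≡⟨ cong (_+ v) (+-comm L (L * z)) ⟩
    L * z + L + v   ≡⟨ +-assoc (L * z) L v ⟩
    L * z + (L + v) ≡⟨ cong (L * z +_) L+v≡u ⟩
    L * z + u       ∎

block≡block : ∀ m {i j} → (∀ {q} → q < m → tm (i * m + q) ≡ tm (j * m + q)) →
              block m i ≡ block m j
block≡block m {i} {j} agree = tabulate-cong λ r → begin
  t (i * m + toℕ r + 1)  ≡⟨ t-+1 (i * m + toℕ r) ⟩
  tm (i * m + toℕ r)     ≡⟨ agree (toℕ<n r) ⟩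
  tm (j * m + toℕ r)     ≡⟨ t-+1 (j * m + toℕ r) ⟨
  t (j * m + toℕ r + 1)  ∎
  where open ≡-Reasoning

repeated-block⇒¬anti-power : ∀ {m i j} → i < j → block m i ≡ block m j →
                             ¬ AntiPowerPrefix (suc j) m
repeated-block⇒¬anti-power {i = i} {j} i<j same anti =
  anti i j (m<n⇒m<1+n i<j) (n<1+n j) (<⇒≢ i<j) same

anti-power? : ∀ k m → Dec (AntiPowerPrefix k m)
anti-power? k m = map′ (λ distinct i i′ i<k → distinct {i} i<k i′)
                       (λ anti {i} i<k i′ → anti i i′ i<k)
                       (allUpTo? distinct? k)
  where
  Distinct : ℕ → Set
  Distinct i = ∀ i′ → i′ < k → i ≢ i′ → block m i ≢ block m i′
  distinct? : Decidable Distinct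
  distinct? i = map′ (λ h i′ → h {i′}) (λ h {i′} → h i′)
    (allUpTo? (λ i′ → ¬? (i ≟ i′) →-dec ¬? (≡-dec _≟ᵇ_ (block m i) (block m i′))) k)

module _ {P : ℕ → Set} (P? : Decidable P) where

  all-below⊎least-failure : ∀ n → (∀ {i} → i < n → P i) ⊎
                            ∃[ k ] (k < n × ¬ P k × (∀ {i} → i < k → P i))
  all-below⊎least-failure zero = inj₁ λ ()
  all-below⊎least-failure (suc n) with all-below⊎least-failure n
  ... | inj₂ (k , k<n , ¬Pk , below) = inj₂ (k , m<n⇒m<1+n k<n , ¬Pk , below)
  ... | inj₁ below with P? n
  ...   | no ¬Pn = inj₂ (n , n<1+n n , ¬Pn , below)
  ...   | yes Pn = inj₁ below′
    where
    below′ : ∀ {i} → i < suc n → P i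
    below′ i<1+n with m<1+n⇒m<n∨m≡n i<1+n
    ... | inj₁ i<n  = below i<n
    ... | inj₂ refl = Pn

IsK-below : ∀ {m k} → ¬ AntiPowerPrefix k m → ∃[ k′ ] (k′ ≤ k × IsK m k′)
IsK-below {m} {k} ¬anti with all-below⊎least-failure (λ k′ → anti-power? k′ m) (suc k)
... | inj₁ below = contradiction (below (n<1+n k)) ¬anti
... | inj₂ (zero , _ , ¬anti₀ , _) = contradiction (λ _ _ ()) ¬anti₀
... | inj₂ (suc k′ , k′<1+k , ¬anti′ , below) =
  suc k′ , m<1+n⇒m≤n k′<1+k , s≤s z≤n , ¬anti′ , λ _ _ k″<1+k′ → below k″<1+k′

n≤2^⌈log₂n⌉ : ∀ n → n ≤ 2 ^ ⌈log₂ n ⌉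
n≤2^⌈log₂n⌉ n = go n (<-wellFounded n)
  where
  go : ∀ n (rec : Acc _<_ n) → n ≤ 2 ^ ⌈log2⌉ n rec
  go zero                _   = z≤n
  go (suc zero)          _   = s≤s z≤n
  go (suc (suc n)) (acc rec) = begin
    2 + n                    ≤⟨ +-monoʳ-≤ 2 n≤h+h ⟩
    2 + (h + h)              ≡⟨ cong (λ y → 2 + (h + y)) (+-identityʳ h) ⟨
    2 + 2 * h                ≡⟨ *-suc 2 h ⟨
    2 * suc h                ≤⟨ *-monoʳ-≤ 2 (go (suc h) _) ⟩
    2 * 2 ^ ⌈log2⌉ (suc h) _ ∎
    where
    open ≤-Reasoning
    h : ℕ
    h = ⌈ n /2⌉
    n≤h+h : n ≤ h + h
    n≤h+h = subst (_≤ h + h) (⌊n/2⌋+⌈n/2⌉≡n n) (+-monoˡ-≤ h (⌊n/2⌋≤⌈n/2⌉ n))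

multiple-above : ∀ m .{{_ : NonZero m}} a → ∃₂ λ i s → s < m × i * m ≡ a + s
multiple-above (suc m) zero = 0 , 0 , z<s , refl
multiple-above (suc m) (suc a) with multiple-above (suc m) a
... | i , suc s , 1+s<1+m , i*m≡a+1+s =
  i , s , m<n⇒m<1+n (m<1+n⇒m≤n 1+s<1+m) , trans i*m≡a+1+s (+-suc a s)
... | i , zero  , _       , i*m≡a+0   = suc i , m , n<1+n m , cong suc (begin
  m + i * suc m  ≡⟨ cong (m +_) (trans i*m≡a+0 (+-identityʳ a)) ⟩
  m + a          ≡⟨ +-comm m a ⟩
  a + m          ∎)
  where open ≡-Reasoning

block-repeats : ∀ ℓ {m n i s} → m ≤ 2 ^ ℓ → s < m → i * m ≡ 2 ^ ℓ * n + s →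
                tm n ≡ tm (m + n) → tm (suc n) ≡ tm (suc (m + n)) →
                block m i ≡ block m (i + 2 ^ ℓ)
block-repeats ℓ {m} {n} {i} {s} m≤L s<m i*m≡Ln+s tm≡ tm-suc≡ =
  block≡block m {i} {i + 2 ^ ℓ} λ {q} q<m → begin
    tm (i * m + q)              ≡⟨ cong tm (trans (cong (_+ q) i*m≡Ln+s) (+-assoc (L * n) s q)) ⟩
    tm (L * n + (s + q))        ≡⟨ tm-agree₂ ℓ tm≡ tm-suc≡ (s+q<L+L q<m) ⟩
    tm (L * (m + n) + (s + q))  ≡⟨ cong tm (later-block q) ⟨
    tm ((i + L) * m + q)        ∎
  where
  open ≡-Reasoning
  L : ℕ
  L = 2 ^ ℓ
  s+q<L+L : ∀ {q} → q < m → s + q < L + L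
  s+q<L+L q<m = +-mono-< (<-≤-trans s<m m≤L) (<-≤-trans q<m m≤L)
  rearrange : ∀ a b c d e → a * b + c + a * d + e ≡ a * (d + b) + (c + e)
  rearrange = solve-∀
  later-block : ∀ q → (i + L) * m + q ≡ L * (m + n) + (s + q)
  later-block q = begin
    (i + L) * m + q       ≡⟨ cong (_+ q) (*-distribʳ-+ m i L) ⟩
    i * m + L * m + q     ≡⟨ cong (λ y → y + L * m + q) i*m≡Ln+s ⟩
    L * n + s + L * m + q ≡⟨ rearrange L n s m q ⟩
    L * (m + n) + (s + q) ∎

repeat-index-bound : ∀ {k i m n s L} → k ≤ suc (i + L) → i * m ≡ L * n + s → s < m →
                     m ≤ L → k * m < (m + suc n + 1) * L
repeat-index-bound {k} {i} {m} {n} {s} {L} k≤1+i+L i*m≡Ln+s s<m m≤L = begin-strict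
  k * m                    ≤⟨ *-monoˡ-≤ m k≤1+i+L ⟩
  suc (i + L) * m          ≡⟨ expand i L m ⟩
  i * m + (L * m + m)      ≡⟨ cong (_+ (L * m + m)) i*m≡Ln+s ⟩
  L * n + s + (L * m + m)  <⟨ +-monoˡ-< (L * m + m) (+-monoʳ-< (L * n) s<m) ⟩
  L * n + m + (L * m + m)  ≤⟨ +-mono-≤ (+-monoʳ-≤ (L * n) m≤L) (+-monoʳ-≤ (L * m) m≤L) ⟩
  L * n + L + (L * m + L)  ≡⟨ collect L n m ⟩
  (m + suc n + 1) * L      ∎
  where
  open ≤-Reasoning
  expand : ∀ a b c → suc (a + b) * c ≡ a * c + (b * c + c)
  expand = solve-∀
  collect : ∀ a b c → a * b + a + (a * c + a) ≡ (c + suc b + 1) * a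
  collect = solve-∀

lemma4 : (m j : ℕ) → 3 ≤ m → ¬ (2 ∣ m) → 1 ≤ j →
         t j ≡ t (m + j) → t (j + 1) ≡ t (m + j + 1) →
         ∃[ k ] (IsK m k × k * m < (m + j + 1) * 2 ^ ⌈log₂ m ⌉)
lemma4 m (suc n) (s≤s _) _ _ tj≡tm+j tj+1≡tm+j+1 =
  let i , s , s<m , i*m≡Ln+s = multiple-above m (L * n)
      repeat = block-repeats ℓ {i = i} m≤L s<m i*m≡Ln+s tm≡ tm-suc≡
      k , k≤1+i+L , isK =
        IsK-below (repeated-block⇒¬anti-power (m<m+n i (m^n>0 2 ℓ)) repeat)
  in  k , isK , repeat-index-bound k≤1+i+L i*m≡Ln+s s<m m≤L
  where
  ℓ L : ℕ
  ℓ = ⌈log₂ m ⌉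
  L = 2 ^ ℓ
  m≤L : m ≤ L
  m≤L = n≤2^⌈log₂n⌉ m
  tm≡ : tm n ≡ tm (m + n)
  tm≡ = trans tj≡tm+j (cong t (+-suc m n))
  tm-suc≡ : tm (suc n) ≡ tm (suc (m + n))
  tm-suc≡ = begin
    tm (suc n)         ≡⟨ t-+1 (suc n) ⟨
    t (suc n + 1)      ≡⟨ tj+1≡tm+j+1 ⟩
    t (m + suc n + 1)  ≡⟨ t-+1 (m + suc n) ⟩
    tm (m + suc n)     ≡⟨ cong tm (+-suc m n) ⟩
    tm (suc (m + n))   ∎
    where open ≡-Reasoning
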